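{- Let $(T',M')$ be a weakly feasible maze pair in a $\delta$-large UFP instance satisfying the standing assumptions below, and let $m\in M'$. Then $|crit(m,T')|\le \frac{4}{\delta^2}+\frac{1}{\delta}$.
   Context: A UFP instance: a path $G=(V,E)$ with vertices $1,\dots,n$ from left to right, edge capacities $u_e\in\mathbb{Z}_{>0}$, and a finite set $T$ of tasks, each task $i$ having a subpath $P(i)$ from $s(i)$ to $t(i)$, demand $d(i)>0$ and profit $w(i)\ge0$. $T_e=\{i:e\in P(i)\}$; $d(S)$ is the sum of demands. The bottleneck capacity is $b(i)=\min_{e\in P(i)}u_e$, $e(i)$ the edge of $P(i)$ with capacity $b(i)$. A task is $\delta$-large if $d(i)\ge\delta b(i)$ ($\delta\in(0,1]$ fixed). Standing assumptions: edge capacities pairwise distinct, $d(i)\le b(i)$ for all $i$, every vertex is the start or end vertex of exactly one task. M-tasks: for every pair of tasks $i,j$ (possibly equal) with $e(i)=e(j)=e$ there is an m-task $m$ with $P(m)=P(i)\cup P(j)$, $b(m)=u_e$, $e(m)=e$, $d(m)=\delta u_e$, profit $0$; $M$ is the set of m-tasks, $M_e=\{m\in M:e\in P(m)\}$. A maze pair is $(T',M')$, $T'\subseteq T$, $M'\subseteq M$, distinct elements of $M'$ having distinct bottleneck capacities. For $m\in M$, $T'\subseteq T$: $T'(m)$ = tasks of $T'$ sharing an edge with $m$; $abv(m,T')=\{i\in T'(m):b(i)>b(m)\}$; $crit(m,T')=\{i\in T'(m): b(m)\ge b(i)\ge\frac\delta2 b(m)\}$; subscript $e$ means intersecting with $T_e$.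 $(T',M')$ is weakly feasible if for every edge $e$: if $M'\cap M_e\ne\emptyset$, with $m_e$ the element of $M'\cap M_e$ of largest bottleneck capacity, $d(abv_e(m_e,T'))+d(crit_e(m_e,T'))+d(m_e)\le u_e$; otherwise $d(T'\cap T_e)\le u_e$. -}

module Defs where

open import Data.Nat as ℕ using (ℕ; zero; suc; _⊓_; _⊔_; _<ᵇ_; _≤ᵇ_)
open import Data.Integer using (+_)
open import Data.Rational as ℚ using (ℚ; 0ℚ; ½; 1/_; >-nonZero)
open import Data.Fin using (Fin)
open import Data.List using (List; foldr; map; filterᵇ; length; allFin)
open import Data.Bool using (Bool; true; false; if_then_else_; _∧_; not)
open import Data.Product using (Σ; _×_; _,_; ∃)
open import Data.Sum using (_⊎_)
import Data.Empty
open import Relation.Binary.PropositionalEquality using (_≡_; _≢_)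

⟦_⟧ : ℕ → ℚ
⟦ n ⟧ = (+ n) ℚ./ 1

sumℚ : List ℚ → ℚ
sumℚ = foldr ℚ._+_ 0ℚ

-- Vertices are 1,…,N (left to right); edge e (for 1 ≤ e < N) joins
-- vertices e and e+1.  Tasks are indexed by Fin k.  Task i has subpath
-- P(i) from s(i) to t(i), i.e. P(i) consists of the edges e with
-- s(i) ≤ e < t(i).

record Instance : Set where
  field
    N   : ℕ
    u   : ℕ → ℕ             -- capacity of edge e (meaningful for 1 ≤ e < N)
    k   : ℕ
    s t : Fin k → ℕ
    d   : Fin k → ℚ
    w   : Fin k → ℚ
    u-pos  : ∀ e → 1 ℕ.≤ e → e ℕ.< N → 0 ℕ.< u e
    s≥1    : ∀ i → 1 ℕ.≤ s i
    s<t    : ∀ i → s i ℕ.< t i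
    t≤N    : ∀ i → t i ℕ.≤ N
    d-pos  : ∀ i → 0ℚ ℚ.< d i
    w-nonneg : ∀ i → 0ℚ ℚ.≤ w i

open Instance public

onPath : ℕ → ℕ → ℕ → Set
onPath a b e = (a ℕ.≤ e) × (e ℕ.< b)

-- argminFrom u a l : the edge among a, a+1, …, a+l of smallest capacity
-- (leftmost one in case of ties; ties do not occur under the standing
-- assumption of pairwise distinct capacities)
argminFrom : (ℕ → ℕ) → ℕ → ℕ → ℕ
argminFrom u a zero = a
argminFrom u a (suc l) =
  let r = argminFrom u (suc a) l in if u a ≤ᵇ u r then a else r

module _ (I : Instance) where

  -- e(i): the edge of P(i) of minimum capacity; P(i) = edges s(i) … t(i)-1
  eT : Fin (k I) → ℕ
  eT i = argminFrom (u I) (s I i) (t I i ℕ.∸ s I i ℕ.∸ 1)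

  bT : Fin (k I) → ℕ
  bT i = u I (eT i)

  InP : Fin (k I) → ℕ → Set
  InP i e = onPath (s I i) (t I i) e

  record Standing : Set where
    field
      cap-distinct : ∀ e e' → 1 ℕ.≤ e → e ℕ.< N I → 1 ℕ.≤ e' → e' ℕ.< N I →
                     u I e ≡ u I e' → e ≡ e'
      d≤b : ∀ i → d I i ℚ.≤ ⟦ bT i ⟧
      vertex-covered : ∀ v → 1 ℕ.≤ v → v ℕ.≤ N I →
                       ∃ λ i → (s I i ≡ v) ⊎ (t I i ≡ v)
      vertex-unique  : ∀ v i j → ((s I i ≡ v) ⊎ (t I i ≡ v)) →
                       ((s I j ≡ v) ⊎ (t I j ≡ v)) → i ≡ j

  Large : ℚ → Set
  Large δ = ∀ i → δ ℚ.* ⟦ bT i ⟧ ℚ.≤ d I i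

  -- The m-task generated by the pair (i , j) (with e(i) = e(j))
  -- has P(m) = P(i) ∪ P(j) (the subpath from min(s i, s j) to
  -- max(t i, t j)), e(m) = e(i), b(m) = u_{e(i)}, d(m) = δ u_{e(m)}, profit 0.

  record MTask : Set where
    constructor mk
    field
      mstart mend medge : ℕ

  open MTask public

  mtask : Fin (k I) → Fin (k I) → MTask
  mtask i j = mk (s I i ⊓ s I j) (t I i ⊔ t I j) (eT i)

  bM : MTask → ℕ
  bM m = u I (medge m)

  dM : ℚ → MTask → ℚ
  dM δ m = δ ℚ.* ⟦ bM m ⟧

  InPM : MTask → ℕ → Set
  InPM m e = onPath (mstart m) (mend m) e

  -- A maze pair (T', M'): T' ⊆ T given as a Boolean predicate on tasks,
  -- M' ⊆ M given as a Boolean predicate on generating pairs (i , j),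
  -- each selected pair satisfying e(i) = e(j), and distinct elements of
  -- M' having distinct bottleneck capacities.
  record MazePair (T' : Fin (k I) → Bool) (M' : Fin (k I) → Fin (k I) → Bool) : Set where
    field
      M'⊆M : ∀ i j → M' i j ≡ true → eT i ≡ eT j
      M'-distinct : ∀ i j i' j' → M' i j ≡ true → M' i' j' ≡ true →
                    mtask i j ≢ mtask i' j' → bM (mtask i j) ≢ bM (mtask i' j')

  inPᵇ : Fin (k I) → ℕ → Bool
  inPᵇ i e = (s I i ≤ᵇ e) ∧ (e <ᵇ t I i)

  sharesᵇ : MTask → Fin (k I) → Bool
  sharesᵇ m i = (s I i <ᵇ mend m) ∧ (mstart m <ᵇ t I i)

  tasks : List (Fin (k I))
  tasks = allFin (k I)

  Tm : (Fin (k I) → Bool) → MTask → List (Fin (k I))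
  Tm T' m = filterᵇ (λ i → T' i ∧ sharesᵇ m i) tasks

  abv : (Fin (k I) → Bool) → MTask → List (Fin (k I))
  abv T' m = filterᵇ (λ i → bM m <ᵇ bT i) (Tm T' m)

  crit : ℚ → (Fin (k I) → Bool) → MTask → List (Fin (k I))
  crit δ T' m = filterᵇ (λ i → (bT i ≤ᵇ bM m) ∧ ((½ ℚ.* δ) ℚ.* ⟦ bM m ⟧ ℚ.≤ᵇ ⟦ bT i ⟧)) (Tm T' m)

  atEdge : ℕ → List (Fin (k I)) → List (Fin (k I))
  atEdge e = filterᵇ (λ i → inPᵇ i e)

  dSum : List (Fin (k I)) → ℚ
  dSum xs = sumℚ (map (d I) xs)

  record WeaklyFeasible (δ : ℚ) (T' : Fin (k I) → Bool) (M' : Fin (k I) → Fin (k I) → Bool) : Set where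
    field
      with-m : ∀ e → 1 ℕ.≤ e → e ℕ.< N I → ∀ i j → M' i j ≡ true →
               InPM (mtask i j) e →
               (∀ i' j' → M' i' j' ≡ true → InPM (mtask i' j') e →
                  bM (mtask i' j') ℕ.≤ bM (mtask i j)) →
               dSum (atEdge e (abv T' (mtask i j)))
                 ℚ.+ dSum (atEdge e (crit δ T' (mtask i j)))
                 ℚ.+ dM δ (mtask i j)
                 ℚ.≤ ⟦ u I e ⟧
      without-m : ∀ e → 1 ℕ.≤ e → e ℕ.< N I →
                  (∀ i j → M' i j ≡ true → InPM (mtask i j) e → Data.Empty.⊥) →
                  dSum (atEdge e (filterᵇ T' tasks)) ℚ.≤ ⟦ u I e ⟧

inv : (δ : ℚ) → 0ℚ ℚ.< δ → ℚ
inv δ δ>0 = (1/ δ) {{>-nonZero δ>0}}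

module Submission where

open import Defs
open import Data.Nat using (ℕ)
open import Data.Fin using (Fin)
open import Data.Bool using (Bool; true)
open import Data.List using (length)
open import Data.Rational using (ℚ; 0ℚ; 1ℚ; _≤_; _<_; _+_; _*_)
open import Relation.Binary.PropositionalEquality using (_≡_)

open import Data.Nat as ℕ using (zero; suc; _≤ᵇ_; _<ᵇ_; _≡ᵇ_; _≤?_; _<?_; s≤s)
import Data.Nat.Properties as ℕP
import Data.Nat.Coprimality as Coprimality
import Data.Integer as ℤ
import Data.Integer.Properties as ℤP
open import Data.Rational as ℚ using (mkℚ; ½; Positive; NonNegative)
import Data.Rational.Properties as ℚP
open import Data.Rational.Solver using (module +-*-Solver)
open +-*-Solver using (solve; _:+_; _:*_; _:=_)
open import Data.Bool using (false; T; if_then_else_; _∧_; _∨_)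
open import Data.Bool.Properties using (T-∧; T-∨; T-≡)
open import Data.List using (List; []; _∷_; map; filterᵇ; cartesianProduct)
open import Data.List.Relation.Unary.All as All using (All; []; _∷_; lookup)
open import Data.List.Relation.Unary.All.Properties using (all-filter)
open import Data.List.Membership.Propositional using (_∈_)
open import Data.List.Membership.Propositional.Properties using (∈-filter⁺; ∈-allFin; ∈-cartesianProduct⁺)
import Data.List.Extrema as Extrema
open import Data.Product using (∃; _×_; _,_; proj₁; proj₂)
open import Data.Sum using (_⊎_; inj₁; inj₂; [_,_]′)
open import Data.Empty using (⊥)
open import Function.Bundles using (Equivalence)
open import Relation.Nullary using (¬_; Dec; yes; no; contradiction)
open import Relation.Nullary.Decidable using (T?)
open import Relation.Binary.Bundles using (TotalOrder)
open import Relation.Binary.Properties.TotalOrder ℕP.≤-totalOrder using (≥-totalOrder)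
open import Relation.Binary.PropositionalEquality using (refl; sym; trans; cong; cong₂; subst; subst₂; module ≡-Reasoning)

-- Let B = b(m) = u_{e₀} with e₀ = e(m).  Every critical task x (b(x) ≤ B,
-- b(x) ≥ (δ/2)B, sharing an edge with m) is of one of three kinds:
--   * left / right: its bottleneck edge e(x) lies left / right of P(m);
--   * centre: e(x) lies on P(m); then B ≤ b(x) ≤ B, so e(x) = e₀ since
--     capacities are distinct.
-- All left tasks pass through the rightmost bottleneck edge g among them, and
-- u_g ≤ B.  The load lemma (from weak feasibility at g, splitting the tasks
-- into abv and crit of the heaviest m-task on g) bounds their total demand by
-- u_g ≤ B, while each has demand ≥ δ·(δ/2)B; hence there are ≤ 2/δ² of them.
-- Symmetrically for right tasks.  Centre tasks use e₀ and have demand ≥ δB;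
-- weak feasibility at e₀ for m gives (|centre| + 1)·δB ≤ B, so |centre| ≤ 1/δ.

⟦⟧-as-mkℚ : ∀ n → ⟦ n ⟧ ≡ mkℚ (ℤ.+ n) 0 (Coprimality.sym (Coprimality.1-coprimeTo n))
⟦⟧-as-mkℚ n = ℚP.normalize-coprime (Coprimality.sym (Coprimality.1-coprimeTo n))

⟦⟧-+ : ∀ m n → ⟦ m ℕ.+ n ⟧ ≡ ⟦ m ⟧ + ⟦ n ⟧
⟦⟧-+ m n rewrite ⟦⟧-as-mkℚ m | ⟦⟧-as-mkℚ n
               | ℕP.*-identityʳ m | ℕP.*-identityʳ n | ℤP.+◃n≡+n m | ℤP.+◃n≡+n n = refl

⟦⟧-mono : ∀ {m n} → m ℕ.≤ n → ⟦ m ⟧ ≤ ⟦ n ⟧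
⟦⟧-mono {m} {n} m≤n rewrite ⟦⟧-as-mkℚ m | ⟦⟧-as-mkℚ n =
  ℚ.*≤* (subst₂ ℤ._≤_ (sym (ℤP.*-identityʳ (ℤ.+ m))) (sym (ℤP.*-identityʳ (ℤ.+ n))) (ℤ.+≤+ m≤n))

⟦suc⟧-* : ∀ n c → ⟦ suc n ⟧ * c ≡ c + ⟦ n ⟧ * c
⟦suc⟧-* n c = begin
  ⟦ 1 ℕ.+ n ⟧ * c        ≡⟨ cong (_* c) (⟦⟧-+ 1 n) ⟩
  (1ℚ + ⟦ n ⟧) * c       ≡⟨ ℚP.*-distribʳ-+ c 1ℚ ⟦ n ⟧ ⟩
  1ℚ * c + ⟦ n ⟧ * c     ≡⟨ cong (_+ ⟦ n ⟧ * c) (ℚP.*-identityˡ c) ⟩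
  c + ⟦ n ⟧ * c          ∎
  where open ≡-Reasoning

≤-+-nonnegʳ : ∀ a {c} → 0ℚ ≤ c → a ≤ a + c
≤-+-nonnegʳ a c≥0 = ℚP.≤-trans (ℚP.≤-reflexive (sym (ℚP.+-identityʳ a))) (ℚP.+-monoʳ-≤ a c≥0)

≤-+-nonnegˡ : ∀ a {c} → 0ℚ ≤ c → a ≤ c + a
≤-+-nonnegˡ a c≥0 = ℚP.≤-trans (ℚP.≤-reflexive (sym (ℚP.+-identityˡ a))) (ℚP.+-monoˡ-≤ a c≥0)

count-bound : ∀ {K C y} n → 0ℚ < K → y * K ≡ C → ⟦ n ⟧ * K ≤ C → ⟦ n ⟧ ≤ y
count-bound {K} n K>0 y*K≡C nK≤C = ℚP.*-cancelʳ-≤-pos K {{ℚ.positive K>0}} (ℚP.≤-trans nK≤C (ℚP.≤-reflexive (sym y*K≡C)))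

∧-split : ∀ {a b} → T (a ∧ b) → T a × T b
∧-split = Equivalence.to T-∧

∧-join : ∀ {a b} → T a → T b → T (a ∧ b)
∧-join ta tb = Equivalence.from T-∧ (ta , tb)

filterᵇ-filterᵇ : ∀ {A : Set} (p q : A → Bool) xs →
                  filterᵇ q (filterᵇ p xs) ≡ filterᵇ (λ x → p x ∧ q x) xs
filterᵇ-filterᵇ p q [] = refl
filterᵇ-filterᵇ p q (x ∷ xs) with p x
... | false = filterᵇ-filterᵇ p q xs
... | true with q x
...   | true  = cong (x ∷_) (filterᵇ-filterᵇ p q xs)
...   | false = filterᵇ-filterᵇ p q xs

filterᵇ-[] : ∀ {A : Set} (p : A → Bool) xs → filterᵇ p xs ≡ [] → ∀ x → x ∈ xs → ¬ T (p x)
filterᵇ-[] p xs empty x x∈xs px with subst (x ∈_) empty (∈-filter⁺ (λ y → T? (p y)) x∈xs px)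
... | ()

module Totals {A : Set} (f : A → ℚ) where

  total : List A → ℚ
  total ys = sumℚ (map f ys)

  total-lower : ∀ {c} ys → All (λ y → c ≤ f y) ys → ⟦ length ys ⟧ * c ≤ total ys
  total-lower {c} [] [] = ℚP.≤-reflexive (ℚP.*-zeroˡ c)
  total-lower {c} (y ∷ ys) (c≤fy ∷ c≤fys) = begin
    ⟦ suc (length ys) ⟧ * c  ≡⟨ ⟦suc⟧-* (length ys) c ⟩
    c + ⟦ length ys ⟧ * c    ≤⟨ ℚP.+-mono-≤ c≤fy (total-lower ys c≤fys) ⟩
    f y + total ys           ∎
    where open ℚP.≤-Reasoning

  module _ (f≥0 : ∀ x → 0ℚ ≤ f x) where

    total-nonneg : ∀ ys → 0ℚ ≤ total ys
    total-nonneg []       = ℚP.≤-refl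
    total-nonneg (y ∷ ys) = ℚP.≤-trans (total-nonneg ys) (≤-+-nonnegˡ (total ys) (f≥0 y))

    selected : Bool → A → ℚ
    selected b x = if b then f x else 0ℚ

    selected-nonneg : ∀ b x → 0ℚ ≤ selected b x
    selected-nonneg true  x = f≥0 x
    selected-nonneg false x = ℚP.≤-refl

    total-filter-∷ : ∀ p x xs → total (filterᵇ p (x ∷ xs)) ≡ selected (p x) x + total (filterᵇ p xs)
    total-filter-∷ p x xs with p x
    ... | true  = refl
    ... | false = sym (ℚP.+-identityˡ _)

    selected-cover : ∀ a b c x → (T a → T b ⊎ T c) → selected a x ≤ selected b x + selected c x
    selected-cover false b c x _ = ℚP.+-mono-≤ (selected-nonneg b x) (selected-nonneg c x)
    selected-cover true  true  c x _ = ≤-+-nonnegʳ (f x) (selected-nonneg c x)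
    selected-cover true  false true  x _ = ≤-+-nonnegˡ (f x) ℚP.≤-refl
    selected-cover true  false false x h with h _
    ... | inj₁ ()
    ... | inj₂ ()

    total-filter-cover : ∀ p q r → (∀ x → T (p x) → T (q x) ⊎ T (r x)) → ∀ xs →
      total (filterᵇ p xs) ≤ total (filterᵇ q xs) + total (filterᵇ r xs)
    total-filter-cover p q r cover [] = ℚP.≤-refl
    total-filter-cover p q r cover (x ∷ xs) = begin
      total (filterᵇ p (x ∷ xs))                             ≡⟨ total-filter-∷ p x xs ⟩
      selected (p x) x + total (filterᵇ p xs)
        ≤⟨ ℚP.+-mono-≤ (selected-cover (p x) (q x) (r x) x (cover x))
                       (total-filter-cover p q r cover xs) ⟩
      (selected (q x) x + selected (r x) x) + (Q + R)         ≡⟨ interchange (selected (q x) x) (selected (r x) x) Q R ⟩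
      (selected (q x) x + Q) + (selected (r x) x + R)
        ≡⟨ sym (cong₂ _+_ (total-filter-∷ q x xs) (total-filter-∷ r x xs)) ⟩
      total (filterᵇ q (x ∷ xs)) + total (filterᵇ r (x ∷ xs)) ∎
      where
      open ℚP.≤-Reasoning
      Q = total (filterᵇ q xs)
      R = total (filterᵇ r xs)
      interchange : ∀ a b c d → (a + b) + (c + d) ≡ (a + c) + (b + d)
      interchange = solve 4 (λ a b c d → (a :+ b) :+ (c :+ d) := (a :+ c) :+ (b :+ d)) refl

    total-filter-mono : ∀ p q → (∀ x → T (p x) → T (q x)) → ∀ xs →
                        total (filterᵇ p xs) ≤ total (filterᵇ q xs)
    total-filter-mono p q p⊆q xs =
      ℚP.≤-trans (total-filter-cover p q (λ _ → false) (λ x px → inj₁ (p⊆q x px)) xs)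
                 (ℚP.≤-reflexive (trans (cong (total (filterᵇ q xs) +_) (nothing-selected xs))
                                        (ℚP.+-identityʳ _)))
      where
      nothing-selected : ∀ ys → total (filterᵇ (λ _ → false) ys) ≡ 0ℚ
      nothing-selected []       = refl
      nothing-selected (_ ∷ ys) = nothing-selected ys

open Totals using (total; total-lower; total-nonneg; total-filter-cover; total-filter-mono)

length-filter-cover : ∀ {A : Set} (p q r : A → Bool) → (∀ x → T (p x) → T (q x) ⊎ T (r x)) → ∀ xs →
  ⟦ length (filterᵇ p xs) ⟧ ≤ ⟦ length (filterᵇ q xs) ⟧ + ⟦ length (filterᵇ r xs) ⟧
length-filter-cover p q r cover xs =
  subst₂ _≤_ (count p) (cong₂ _+_ (count q) (count r))
         (total-filter-cover one (λ _ → ℚP.<⇒≤ (ℚP.positive⁻¹ 1ℚ)) p q r cover xs)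
  where
  one = λ _ → 1ℚ
  length-as-total : ∀ ys → total one ys ≡ ⟦ length ys ⟧
  length-as-total []       = refl
  length-as-total (_ ∷ ys) = trans (cong (1ℚ +_) (length-as-total ys)) (sym (⟦⟧-+ 1 (length ys)))
  count : ∀ p → total one (filterᵇ p xs) ≡ ⟦ length (filterᵇ p xs) ⟧
  count p = length-as-total (filterᵇ p xs)

module Extremal {c ℓ₁ ℓ₂} (O : TotalOrder c ℓ₁ ℓ₂) where
  open TotalOrder O using (Carrier) renaming (_≤_ to _≼_)
  open Extrema O using (argmax; argmax-all; f[⊥]≤f[argmax]; f[xs]≤f[argmax])

  extremal : ∀ {A : Set} (f : A → Carrier) (p : A → Bool) xs →
             filterᵇ p xs ≡ [] ⊎ ∃ λ g → T (p g) × (∀ x → x ∈ xs → T (p x) → f x ≼ f g)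
  extremal f p xs =
    pick (filterᵇ p xs) (all-filter (λ x → T? (p x)) xs) (λ x x∈xs → ∈-filter⁺ (λ x → T? (p x)) x∈xs)
    where
    pick : ∀ ys → All (λ x → T (p x)) ys → (∀ x → x ∈ xs → T (p x) → x ∈ ys) →
           ys ≡ [] ⊎ ∃ λ g → T (p g) × (∀ x → x ∈ xs → T (p x) → f x ≼ f g)
    pick []       _          _     = inj₁ refl
    pick (y ∷ ys) (py ∷ pys) in-ys =
      inj₂ (argmax f y ys , argmax-all f py pys ,
            λ x x∈xs px → lookup (f[⊥]≤f[argmax] {f = f} y ys ∷ f[xs]≤f[argmax] {f = f} y ys) (in-ys x x∈xs px))

open Extremal ℕP.≤-totalOrder renaming (extremal to maximiser)
open Extremal ≥-totalOrder renaming (extremal to minimiser)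

argminFrom-range : ∀ u a l → a ℕ.≤ argminFrom u a l × argminFrom u a l ℕ.≤ a ℕ.+ l
argminFrom-range u a zero = ℕP.≤-refl , ℕP.m≤m+n a 0
argminFrom-range u a (suc l) with u a ≤ᵇ u (argminFrom u (suc a) l) | argminFrom-range u (suc a) l
... | true  | _          = ℕP.≤-refl , ℕP.m≤m+n a (suc l)
... | false | (lo , hi)  = ℕP.≤-trans (ℕP.n≤1+n a) lo , ℕP.≤-trans hi (ℕP.≤-reflexive (sym (ℕP.+-suc a l)))

argminFrom-min : ∀ u a l e → a ℕ.≤ e → e ℕ.≤ a ℕ.+ l → u (argminFrom u a l) ℕ.≤ u e
argminFrom-min u a zero e a≤e e≤a+0 =
  ℕP.≤-reflexive (cong u (ℕP.≤-antisym a≤e (subst (e ℕ.≤_) (ℕP.+-identityʳ a) e≤a+0)))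
argminFrom-min u a (suc l) e a≤e e≤a+l+1
  with u a ≤ᵇ u (argminFrom u (suc a) l) in test | ℕP.m≤n⇒m<n∨m≡n a≤e
... | true  | inj₂ refl = ℕP.≤-refl
... | true  | inj₁ a<e  = ℕP.≤-trans (ℕP.≤ᵇ⇒≤ _ _ (Equivalence.from T-≡ test))
                            (argminFrom-min u (suc a) l e a<e (subst (e ℕ.≤_) (ℕP.+-suc a l) e≤a+l+1))
... | false | inj₂ refl = ℕP.<⇒≤ (ℕP.≰⇒> (λ le → subst T test (ℕP.≤⇒≤ᵇ le)))
... | false | inj₁ a<e  = argminFrom-min u (suc a) l e a<e (subst (e ℕ.≤_) (ℕP.+-suc a l) e≤a+l+1)

last-edge : ∀ s t → s ℕ.< t → suc (s ℕ.+ (t ℕ.∸ s ℕ.∸ 1)) ≡ t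
last-edge zero    (suc t) _         = refl
last-edge (suc s) (suc t) (s≤s s<t) = cong suc (last-edge s t s<t)

⊓-≤-other : ∀ {m n e} → m ℕ.⊓ n ℕ.≤ e → ¬ m ℕ.≤ e → n ℕ.≤ e
⊓-≤-other {m} {n} {e} h m≰e with ℕP.⊓-sel m n
... | inj₁ eq = contradiction (subst (ℕ._≤ e) eq h) m≰e
... | inj₂ eq = subst (ℕ._≤ e) eq h

<-⊔-other : ∀ {m n e} → e ℕ.< m ℕ.⊔ n → ¬ e ℕ.< m → e ℕ.< n
<-⊔-other {m} {n} {e} h e≮m with ℕP.⊔-sel m n
... | inj₁ eq = contradiction (subst (e ℕ.<_) eq h) e≮m
... | inj₂ eq = subst (e ℕ.<_) eq h

module Bottleneck (I : Instance) where

  inPᵇ-complete : ∀ x e → InP I x e → T (inPᵇ I x e)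
  inPᵇ-complete x e (lo , hi) = ∧-join (ℕP.≤⇒≤ᵇ lo) (ℕP.<⇒<ᵇ hi)

  sharesᵇ-sound : ∀ m x → T (sharesᵇ I m x) → s I x ℕ.< mend m × mstart m ℕ.< t I x
  sharesᵇ-sound m x h = let (l , r) = ∧-split h in ℕP.<ᵇ⇒< _ _ l , ℕP.<ᵇ⇒< _ _ r

  sharesᵇ-complete : ∀ m x e → InPM I m e → InP I x e → T (sharesᵇ I m x)
  sharesᵇ-complete m x e (m-lo , m-hi) (x-lo , x-hi) =
    ∧-join (ℕP.<⇒<ᵇ (ℕP.≤-<-trans x-lo m-hi)) (ℕP.<⇒<ᵇ (ℕP.≤-<-trans m-lo x-hi))

  bottleneck-on-path : ∀ x → InP I x (eT I x)
  bottleneck-on-path x =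
    lo , ℕP.≤-<-trans hi (ℕP.≤-reflexive (last-edge (s I x) (t I x) (s<t I x)))
    where
    lo-hi = argminFrom-range (u I) (s I x) (t I x ℕ.∸ s I x ℕ.∸ 1)
    lo = proj₁ lo-hi
    hi = proj₂ lo-hi

  bottleneck-min : ∀ x e → InP I x e → bT I x ℕ.≤ u I e
  bottleneck-min x e (lo , hi) =
    argminFrom-min (u I) (s I x) _ e lo
      (ℕP.≤-pred (ℕP.≤-trans hi (ℕP.≤-reflexive (sym (last-edge (s I x) (t I x) (s<t I x))))))

  path-edge-valid : ∀ x e → InP I x e → 1 ℕ.≤ e × e ℕ.< N I
  path-edge-valid x e (lo , hi) = ℕP.≤-trans (s≥1 I x) lo , ℕP.<-≤-trans hi (t≤N I x)

  bottleneck-valid : ∀ x → 1 ℕ.≤ eT I x × eT I x ℕ.< N I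
  bottleneck-valid x = path-edge-valid x (eT I x) (bottleneck-on-path x)

  -- For e(a) = e(b), P(a) ∪ P(b) is an interval, so P(mtask a b) = P(a) ∪ P(b).
  mtask-path : ∀ a b e → eT I a ≡ eT I b → InPM I (mtask I a b) e → InP I a e ⊎ InP I b e
  mtask-path a b e same (lo , hi) with s I a ≤? e | e <? t I a
  ... | yes a-lo | yes a-hi = inj₁ (a-lo , a-hi)
  ... | yes _    | no  e≮ta = inj₂ (b-lo , <-⊔-other hi e≮ta)
    where
    b-lo : s I b ℕ.≤ e
    b-lo = begin
      s I b   ≤⟨ proj₁ (bottleneck-on-path b) ⟩
      eT I b  ≡⟨ sym same ⟩
      eT I a  ≤⟨ ℕP.<⇒≤ (proj₂ (bottleneck-on-path a)) ⟩
      t I a   ≤⟨ ℕP.≮⇒≥ e≮ta ⟩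
      e       ∎
      where open ℕP.≤-Reasoning
  ... | no e<sa  | _        = inj₂ (⊓-≤-other lo e<sa , b-hi)
    where
    b-hi : e ℕ.< t I b
    b-hi = begin-strict
      e       <⟨ ℕP.≰⇒> e<sa ⟩
      s I a   ≤⟨ proj₁ (bottleneck-on-path a) ⟩
      eT I a  ≡⟨ same ⟩
      eT I b  <⟨ proj₂ (bottleneck-on-path b) ⟩
      t I b   ∎
      where open ℕP.≤-Reasoning

  mtask-min : ∀ a b e → eT I a ≡ eT I b → InPM I (mtask I a b) e → bM I (mtask I a b) ℕ.≤ u I e
  mtask-min a b e same on-m with mtask-path a b e same on-m
  ... | inj₁ on-a = bottleneck-min a e on-a
  ... | inj₂ on-b = subst (ℕ._≤ u I e) (cong (u I) (sym same)) (bottleneck-min b e on-b)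

  mtask-on-path : ∀ a b → InPM I (mtask I a b) (eT I a)
  mtask-on-path a b =
    ℕP.≤-trans (ℕP.m⊓n≤m (s I a) (s I b)) (proj₁ (bottleneck-on-path a)) ,
    ℕP.<-≤-trans (proj₂ (bottleneck-on-path a)) (ℕP.m≤m⊔n (t I a) (t I b))

module Scaling (δ : ℚ) (δ>0 : 0ℚ < δ) where

  δ⁻¹ : ℚ
  δ⁻¹ = inv δ δ>0

  δ*δ⁻¹ : δ * δ⁻¹ ≡ 1ℚ
  δ*δ⁻¹ = ℚP.*-inverseʳ δ {{ℚ.>-nonZero δ>0}}

  stack-scale : ∀ C → (⟦ 2 ⟧ * (δ⁻¹ * δ⁻¹)) * (δ * ((½ * δ) * C)) ≡ C
  stack-scale C = begin
    (⟦ 2 ⟧ * (δ⁻¹ * δ⁻¹)) * (δ * ((½ * δ) * C))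
      ≡⟨ solve 5 (λ t h d x c → (t :* (x :* x)) :* (d :* ((h :* d) :* c))
                                := (t :* h) :* ((d :* x) :* ((d :* x) :* c))) refl ⟦ 2 ⟧ ½ δ δ⁻¹ C ⟩
    (⟦ 2 ⟧ * ½) * ((δ * δ⁻¹) * ((δ * δ⁻¹) * C))
      ≡⟨ cong (λ z → (⟦ 2 ⟧ * ½) * (z * (z * C))) δ*δ⁻¹ ⟩
    1ℚ * (1ℚ * (1ℚ * C))
      ≡⟨ trans (ℚP.*-identityˡ _) (trans (ℚP.*-identityˡ _) (ℚP.*-identityˡ C)) ⟩
    C ∎
    where open ≡-Reasoning

  edge-scale : ∀ C → δ⁻¹ * (δ * C) ≡ C
  edge-scale C = begin
    δ⁻¹ * (δ * C)   ≡⟨ solve 3 (λ x d c → x :* (d :* c) := (d :* x) :* c) refl δ⁻¹ δ C ⟩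
    (δ * δ⁻¹) * C   ≡⟨ cong (_* C) δ*δ⁻¹ ⟩
    1ℚ * C          ≡⟨ ℚP.*-identityˡ C ⟩
    C               ∎
    where open ≡-Reasoning

module Load (δ : ℚ) (δ>0 : 0ℚ < δ) (I : Instance) (large : Large I δ)
            (T' : Fin (k I) → Bool) (M' : Fin (k I) → Fin (k I) → Bool)
            (maze : MazePair I T' M') (feasible : WeaklyFeasible I δ T' M') where
  open Bottleneck I
  open MazePair maze
  open WeaklyFeasible feasible

  instance
    δ-pos : Positive δ
    δ-pos = ℚ.positive δ>0
    δ/2-nonNeg : NonNegative (½ * δ)
    δ/2-nonNeg = ℚP.pos⇒nonNeg (½ * δ) {{ℚP.pos*pos⇒pos ½ δ}}
    δ-nonNeg : NonNegative δ
    δ-nonNeg = ℚP.pos⇒nonNeg δ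

  d≥0 : ∀ x → 0ℚ ≤ d I x
  d≥0 x = ℚP.<⇒≤ (d-pos I x)

  demand : (Fin (k I) → Bool) → ℚ
  demand p = dSum I (filterᵇ p (tasks I))

  coversᵇ : ℕ → Fin (k I) × Fin (k I) → Bool
  coversᵇ g (a , b) = M' a b ∧ ((mstart (mtask I a b) ≤ᵇ g) ∧ (g <ᵇ mend (mtask I a b)))

  coversᵇ-sound : ∀ g a b → T (coversᵇ g (a , b)) → M' a b ≡ true × InPM I (mtask I a b) g
  coversᵇ-sound g a b h =
    let (in-M' , lo-hi) = ∧-split h ; (lo , hi) = ∧-split lo-hi
    in Equivalence.to T-≡ in-M' , ℕP.≤ᵇ⇒≤ _ _ lo , ℕP.<ᵇ⇒< _ _ hi

  coversᵇ-complete : ∀ g a b → M' a b ≡ true → InPM I (mtask I a b) g → T (coversᵇ g (a , b))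
  coversᵇ-complete g a b in-M' (lo , hi) =
    ∧-join (Equivalence.from T-≡ in-M') (∧-join (ℕP.≤⇒≤ᵇ lo) (ℕP.<⇒<ᵇ hi))

  pairs : List (Fin (k I) × Fin (k I))
  pairs = cartesianProduct (tasks I) (tasks I)

  pair∈ : ∀ a b → (a , b) ∈ pairs
  pair∈ a b = ∈-cartesianProduct⁺ (∈-allFin a) (∈-allFin b)

  Loaded : (Fin (k I) → Bool) → ℕ → ℕ → Set
  Loaded p g c = ∀ x → T (p x) → T (T' x) × InP I x g × (½ * δ) * ⟦ c ⟧ ≤ ⟦ bT I x ⟧

  load-without-mtask : ∀ g p → 1 ℕ.≤ g → g ℕ.< N I →
    (∀ a b → M' a b ≡ true → InPM I (mtask I a b) g → ⊥) →
    Loaded p g (u I g) → demand p ≤ ⟦ u I g ⟧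
  load-without-mtask g p g≥1 g<N none loaded = begin
    demand p                                ≤⟨ total-filter-mono (d I) d≥0 p on-g on-g-sel (tasks I) ⟩
    dSum I (filterᵇ on-g (tasks I))         ≡⟨ cong (dSum I) (sym (filterᵇ-filterᵇ T' (λ x → inPᵇ I x g) (tasks I))) ⟩
    dSum I (atEdge I g (filterᵇ T' (tasks I))) ≤⟨ without-m g g≥1 g<N none ⟩
    ⟦ u I g ⟧                               ∎
    where
    open ℚP.≤-Reasoning
    on-g : Fin (k I) → Bool
    on-g x = T' x ∧ inPᵇ I x g
    on-g-sel : ∀ x → T (p x) → T (on-g x)
    on-g-sel x px = let (in-T' , uses-g , _) = loaded x px in ∧-join in-T' (inPᵇ-complete x g uses-g)

  -- If m_g = mtask a b is the m-task of M' on g of largest bottleneck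
  -- capacity, every selected task is either above or critical for m_g, so
  -- weak feasibility at g bounds their demand.
  load-with-mtask : ∀ g p a b → 1 ℕ.≤ g → g ℕ.< N I → M' a b ≡ true → InPM I (mtask I a b) g →
    (∀ a' b' → M' a' b' ≡ true → InPM I (mtask I a' b') g → bM I (mtask I a' b') ℕ.≤ bM I (mtask I a b)) →
    Loaded p g (u I g) → demand p ≤ ⟦ u I g ⟧
  load-with-mtask g p a b g≥1 g<N in-M' mg-uses-g heaviest loaded = begin
    demand p                                    ≤⟨ total-filter-cover (d I) d≥0 p (at-g above) (at-g critical) split (tasks I) ⟩
    demand (at-g above) + demand (at-g critical) ≡⟨ sym (cong₂ _+_ (cong (dSum I) (at-g-filter above))
                                                                    (cong (dSum I) (at-g-filter critical))) ⟩
    dSum I (atEdge I g (abv I T' mg)) + dSum I (atEdge I g (crit I δ T' mg))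
                                                ≤⟨ ≤-+-nonnegʳ _ dM≥0 ⟩
    dSum I (atEdge I g (abv I T' mg)) + dSum I (atEdge I g (crit I δ T' mg)) + dM I δ mg
                                                ≤⟨ with-m g g≥1 g<N a b in-M' mg-uses-g heaviest ⟩
    ⟦ u I g ⟧                                   ∎
    where
    open ℚP.≤-Reasoning
    mg = mtask I a b
    in-Tm above critical : Fin (k I) → Bool
    in-Tm x    = T' x ∧ sharesᵇ I mg x
    above x    = bM I mg <ᵇ bT I x
    critical x = (bT I x ≤ᵇ bM I mg) ∧ ((½ * δ) * ⟦ bM I mg ⟧ ℚ.≤ᵇ ⟦ bT I x ⟧)
    at-g : (Fin (k I) → Bool) → Fin (k I) → Bool
    at-g q x = (in-Tm x ∧ q x) ∧ inPᵇ I x g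
    at-g-filter : ∀ q → atEdge I g (filterᵇ q (filterᵇ in-Tm (tasks I))) ≡ filterᵇ (at-g q) (tasks I)
    at-g-filter q = trans (cong (atEdge I g) (filterᵇ-filterᵇ in-Tm q (tasks I)))
                          (filterᵇ-filterᵇ (λ x → in-Tm x ∧ q x) (λ x → inPᵇ I x g) (tasks I))
    dM≥0 : 0ℚ ≤ dM I δ mg
    dM≥0 = ℚP.≤-trans (ℚP.≤-reflexive (sym (ℚP.*-zeroʳ δ))) (ℚP.*-monoˡ-≤-nonNeg δ (⟦⟧-mono {0} {bM I mg} ℕ.z≤n))
    bM≤ug : bM I mg ℕ.≤ u I g
    bM≤ug = mtask-min a b g (M'⊆M a b in-M') mg-uses-g
    split : ∀ x → T (p x) → T (at-g above x) ⊎ T (at-g critical x)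
    split x px with loaded x px | bM I mg <? bT I x
    ... | in-T' , x-uses-g , _ | yes mg<x =
      inj₁ (∧-join (∧-join (∧-join in-T' (sharesᵇ-complete mg x g mg-uses-g x-uses-g)) (ℕP.<⇒<ᵇ mg<x))
                   (inPᵇ-complete x g x-uses-g))
    ... | in-T' , x-uses-g , big | no mg≮x =
      inj₂ (∧-join (∧-join (∧-join in-T' (sharesᵇ-complete mg x g mg-uses-g x-uses-g))
                           (∧-join (ℕP.≤⇒≤ᵇ (ℕP.≮⇒≥ mg≮x)) (ℚP.≤⇒≤ᵇ crit-lower)))
                   (inPᵇ-complete x g x-uses-g))
      where
      crit-lower : (½ * δ) * ⟦ bM I mg ⟧ ≤ ⟦ bT I x ⟧
      crit-lower = ℚP.≤-trans (ℚP.*-monoˡ-≤-nonNeg (½ * δ) (⟦⟧-mono bM≤ug)) big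

  edge-load : ∀ g p → 1 ℕ.≤ g → g ℕ.< N I → Loaded p g (u I g) → demand p ≤ ⟦ u I g ⟧
  edge-load g p g≥1 g<N loaded with maximiser (λ (a , b) → bM I (mtask I a b)) (coversᵇ g) pairs
  ... | inj₁ none = load-without-mtask g p g≥1 g<N
        (λ a b in-M' uses-g → filterᵇ-[] (coversᵇ g) pairs none (a , b) (pair∈ a b) (coversᵇ-complete g a b in-M' uses-g))
        loaded
  ... | inj₂ ((a , b) , covers , heaviest) =
        let (in-M' , uses-g) = coversᵇ-sound g a b covers
        in load-with-mtask g p a b g≥1 g<N in-M' uses-g
             (λ a' b' in-M'' uses-g' → heaviest (a' , b') (pair∈ a' b') (coversᵇ-complete g a' b' in-M'' uses-g'))
             loaded

  -- Stacking lemma: tasks of T' through a common edge g with u_g ≤ c, each of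
  -- bottleneck at least (δ/2)·c, are at most c / (δ·(δ/2)·c) many, since each
  -- has demand at least δ·(δ/2)·c by δ-largeness.
  stack-bound : ∀ g c p → 1 ℕ.≤ g → g ℕ.< N I → u I g ℕ.≤ c → Loaded p g c →
    ⟦ length (filterᵇ p (tasks I)) ⟧ * (δ * ((½ * δ) * ⟦ c ⟧)) ≤ ⟦ c ⟧
  stack-bound g c p g≥1 g<N ug≤c loaded = begin
    ⟦ length (filterᵇ p (tasks I)) ⟧ * (δ * ((½ * δ) * ⟦ c ⟧)) ≤⟨ total-lower (d I) _ heavy ⟩
    demand p                                                   ≤⟨ edge-load g p g≥1 g<N loaded-at-g ⟩
    ⟦ u I g ⟧                                                  ≤⟨ ⟦⟧-mono ug≤c ⟩
    ⟦ c ⟧                                                      ∎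
    where
    open ℚP.≤-Reasoning
    heavy : All (λ x → δ * ((½ * δ) * ⟦ c ⟧) ≤ d I x) (filterᵇ p (tasks I))
    heavy = All.map (λ {x} px → ℚP.≤-trans (ℚP.*-monoˡ-≤-nonNeg δ (proj₂ (proj₂ (loaded x px)))) (large x))
                    (all-filter (λ x → T? (p x)) (tasks I))
    loaded-at-g : Loaded p g (u I g)
    loaded-at-g x px =
      let (in-T' , uses-g , big) = loaded x px
      in in-T' , uses-g , ℚP.≤-trans (ℚP.*-monoˡ-≤-nonNeg (½ * δ) (⟦⟧-mono ug≤c)) big

  module Critical (standing : Standing I) (i j : Fin (k I)) (i,j∈M' : M' i j ≡ true) where
    open Standing standing
    open Scaling δ δ>0

    m : MTask I
    m = mtask I i j

    B : ℕ
    B = bM I m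

    e₀ : ℕ
    e₀ = eT I i

    critᵇ : Fin (k I) → Bool
    critᵇ x = (T' x ∧ sharesᵇ I m x) ∧ ((bT I x ≤ᵇ B) ∧ ((½ * δ) * ⟦ B ⟧ ℚ.≤ᵇ ⟦ bT I x ⟧))

    crit-filter : crit I δ T' m ≡ filterᵇ critᵇ (tasks I)
    crit-filter = filterᵇ-filterᵇ (λ x → T' x ∧ sharesᵇ I m x)
                    (λ x → (bT I x ≤ᵇ B) ∧ ((½ * δ) * ⟦ B ⟧ ℚ.≤ᵇ ⟦ bT I x ⟧)) (tasks I)

    critᵇ-sound : ∀ x → T (critᵇ x) →
      T (T' x) × (s I x ℕ.< mend m × mstart m ℕ.< t I x) × bT I x ℕ.≤ B × (½ * δ) * ⟦ B ⟧ ≤ ⟦ bT I x ⟧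
    critᵇ-sound x h =
      let (in-Tm , bounds) = ∧-split h ; (in-T' , shares) = ∧-split in-Tm ; (upper , lower) = ∧-split bounds
      in in-T' , sharesᵇ-sound m x shares , ℕP.≤ᵇ⇒≤ (bT I x) B upper , ℚP.≤ᵇ⇒≤ {(½ * δ) * ⟦ B ⟧} {⟦ bT I x ⟧} lower

    leftᵇ rightᵇ centreᵇ : Fin (k I) → Bool
    leftᵇ x   = critᵇ x ∧ (eT I x <ᵇ mstart m)
    rightᵇ x  = critᵇ x ∧ (mend m ≤ᵇ eT I x)
    centreᵇ x = critᵇ x ∧ (eT I x ≡ᵇ e₀)

    -- A critical task with bottleneck edge on P(m) has b(x) ≤ b(m) ≤ b(x), so
    -- e(x) = e₀ as capacities are distinct.
    inner-bottleneck : ∀ x → T (critᵇ x) → InPM I m (eT I x) → eT I x ≡ e₀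
    inner-bottleneck x x-crit on-m =
      cap-distinct (eT I x) e₀ (proj₁ (bottleneck-valid x)) (proj₂ (bottleneck-valid x))
                   (proj₁ (bottleneck-valid i)) (proj₂ (bottleneck-valid i))
                   (ℕP.≤-antisym (proj₁ (proj₂ (proj₂ (critᵇ-sound x x-crit))))
                                 (mtask-min i j (eT I x) (M'⊆M i j i,j∈M') on-m))

    crit-partition : ∀ x → T (critᵇ x) → T (leftᵇ x) ⊎ T (rightᵇ x ∨ centreᵇ x)
    crit-partition x x-crit = classify (eT I x <? mstart m) (mend m ℕ.≤? eT I x)
      where
      classify : Dec (eT I x ℕ.< mstart m) → Dec (mend m ℕ.≤ eT I x) → T (leftᵇ x) ⊎ T (rightᵇ x ∨ centreᵇ x)
      classify (yes left) _         = inj₁ (∧-join x-crit (ℕP.<⇒<ᵇ left))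
      classify (no _)     (yes right) = inj₂ (Equivalence.from T-∨ (inj₁ (∧-join x-crit (ℕP.≤⇒≤ᵇ right))))
      classify (no ¬left) (no ¬right) =
        inj₂ (Equivalence.from T-∨ (inj₂ (∧-join x-crit (ℕP.≡⇒≡ᵇ (eT I x) e₀ centre))))
        where
        centre = inner-bottleneck x x-crit (ℕP.≮⇒≥ ¬left , ℕP.≰⇒> ¬right)

    size : (Fin (k I) → Bool) → ℕ
    size p = length (filterᵇ p (tasks I))

    count : (Fin (k I) → Bool) → ℚ
    count p = ⟦ size p ⟧

    crit-count : ⟦ length (crit I δ T' m) ⟧ ≤ count leftᵇ + (count rightᵇ + count centreᵇ)
    crit-count = begin
      ⟦ length (crit I δ T' m) ⟧                      ≡⟨ cong (λ l → ⟦ length l ⟧) crit-filter ⟩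
      count critᵇ                                     ≤⟨ length-filter-cover critᵇ leftᵇ right-or-centre
                                                                             crit-partition (tasks I) ⟩
      count leftᵇ + count right-or-centre             ≤⟨ ℚP.+-monoʳ-≤ (count leftᵇ)
                                                           (length-filter-cover right-or-centre rightᵇ centreᵇ
                                                                                (λ x → Equivalence.to T-∨) (tasks I)) ⟩
      count leftᵇ + (count rightᵇ + count centreᵇ)    ∎
      where
      open ℚP.≤-Reasoning
      right-or-centre : Fin (k I) → Bool
      right-or-centre x = rightᵇ x ∨ centreᵇ x

    B>0 : 0ℚ < ⟦ B ⟧
    B>0 = ℚP.<-≤-trans (ℚP.positive⁻¹ 1ℚ) (⟦⟧-mono (u-pos I e₀ (proj₁ (bottleneck-valid i)) (proj₂ (bottleneck-valid i))))

    instance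
      B-pos : Positive ⟦ B ⟧
      B-pos = ℚ.positive B>0

    -- the minimum demand of a critical task, and its positivity
    K : ℚ
    K = δ * ((½ * δ) * ⟦ B ⟧)

    K>0 : 0ℚ < K
    K>0 = ℚP.positive⁻¹ K {{ℚP.pos*pos⇒pos δ ((½ * δ) * ⟦ B ⟧) {{ℚP.pos*pos⇒pos (½ * δ) {{ℚP.pos*pos⇒pos ½ δ}} ⟦ B ⟧}}}}

    empty-count : ∀ p → filterᵇ p (tasks I) ≡ [] → count p * K ≤ ⟦ B ⟧
    empty-count p none rewrite none = ℚP.≤-trans (ℚP.≤-reflexive (ℚP.*-zeroˡ K)) (⟦⟧-mono {0} {B} ℕ.z≤n)

    -- the stacking lemma at the bottleneck edge of a critical task g, for
    -- critical tasks passing through it (u_{e(g)} = b(g) ≤ B)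
    stack-at : ∀ p g → T (critᵇ g) → (∀ x → T (p x) → T (critᵇ x) × InP I x (eT I g)) → count p * K ≤ ⟦ B ⟧
    stack-at p g g-crit through =
      stack-bound (eT I g) B p (proj₁ (bottleneck-valid g)) (proj₂ (bottleneck-valid g))
                  (proj₁ (proj₂ (proj₂ (critᵇ-sound g g-crit)))) loaded
      where
      loaded : Loaded p (eT I g) B
      loaded x px =
        let (x-crit , uses-g) = through x px
            (in-T' , _ , _ , big) = critᵇ-sound x x-crit
        in in-T' , uses-g , big

    -- All left tasks pass through the rightmost of their bottleneck edges.
    left-count : count leftᵇ * K ≤ ⟦ B ⟧
    left-count = [ empty-count leftᵇ , stack-at-rightmost ]′ (maximiser (eT I) leftᵇ (tasks I))
      where
      stack-at-rightmost : (∃ λ g → T (leftᵇ g) × (∀ x → x ∈ tasks I → T (leftᵇ x) → eT I x ℕ.≤ eT I g)) →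
                           count leftᵇ * K ≤ ⟦ B ⟧
      stack-at-rightmost (g , g-left , rightmost) = stack-at leftᵇ g (proj₁ (∧-split g-left)) through-g
        where
        g-before-m : eT I g ℕ.< mstart m
        g-before-m = ℕP.<ᵇ⇒< (eT I g) (mstart m) (proj₂ (∧-split g-left))
        through-g : ∀ x → T (leftᵇ x) → T (critᵇ x) × InP I x (eT I g)
        through-g x x-left =
          let x-crit = proj₁ (∧-split x-left)
              (_ , (_ , m-before-tx) , _) = critᵇ-sound x x-crit
          in x-crit , ℕP.≤-trans (proj₁ (bottleneck-on-path x)) (rightmost x (∈-allFin x) x-left) ,
                      ℕP.<-trans g-before-m m-before-tx

    -- Symmetrically, right tasks pass through the leftmost of their bottleneck edges.
    right-count : count rightᵇ * K ≤ ⟦ B ⟧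
    right-count = [ empty-count rightᵇ , stack-at-leftmost ]′ (minimiser (eT I) rightᵇ (tasks I))
      where
      stack-at-leftmost : (∃ λ g → T (rightᵇ g) × (∀ x → x ∈ tasks I → T (rightᵇ x) → eT I g ℕ.≤ eT I x)) →
                          count rightᵇ * K ≤ ⟦ B ⟧
      stack-at-leftmost (g , g-right , leftmost) = stack-at rightᵇ g (proj₁ (∧-split g-right)) through-g
        where
        m-before-g : mend m ℕ.≤ eT I g
        m-before-g = ℕP.≤ᵇ⇒≤ (mend m) (eT I g) (proj₂ (∧-split g-right))
        through-g : ∀ x → T (rightᵇ x) → T (critᵇ x) × InP I x (eT I g)
        through-g x x-right =
          let x-crit = proj₁ (∧-split x-right)
              (_ , (sx-before-m , _) , _) = critᵇ-sound x x-crit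
          in x-crit , ℕP.<⇒≤ (ℕP.<-≤-trans sx-before-m m-before-g) ,
                      ℕP.≤-<-trans (leftmost x (∈-allFin x) x-right) (proj₂ (bottleneck-on-path x))

    centre-bottleneck : ∀ x → T (centreᵇ x) → eT I x ≡ e₀
    centre-bottleneck x h = ℕP.≡ᵇ⇒≡ (eT I x) e₀ (proj₂ (∧-split h))

    crit-on-e₀ : Fin (k I) → Bool
    crit-on-e₀ x = critᵇ x ∧ inPᵇ I x e₀

    -- Centre tasks have demand at least δ·B each and are critical tasks on e₀,
    -- so they are at most a (δ·B)-th of d(abv_{e₀}(m)) + d(crit_{e₀}(m)).
    centre-demand : ⟦ size centreᵇ ⟧ * (δ * ⟦ B ⟧)
                      ≤ dSum I (atEdge I e₀ (abv I T' m)) + dSum I (atEdge I e₀ (crit I δ T' m))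
    centre-demand = begin
      ⟦ size centreᵇ ⟧ * (δ * ⟦ B ⟧)   ≤⟨ total-lower (d I) (filterᵇ centreᵇ (tasks I)) heavy ⟩
      demand centreᵇ                   ≤⟨ total-filter-mono (d I) d≥0 centreᵇ crit-on-e₀ centre-on-e₀ (tasks I) ⟩
      demand crit-on-e₀                ≡⟨ cong (dSum I) (sym (trans (cong (atEdge I e₀) crit-filter)
                                                                      (filterᵇ-filterᵇ critᵇ (λ x → inPᵇ I x e₀) (tasks I)))) ⟩
      crit-e₀                          ≤⟨ ≤-+-nonnegˡ crit-e₀ (total-nonneg (d I) d≥0 (atEdge I e₀ (abv I T' m))) ⟩
      dSum I (atEdge I e₀ (abv I T' m)) + crit-e₀ ∎
      where
      open ℚP.≤-Reasoning
      crit-e₀ = dSum I (atEdge I e₀ (crit I δ T' m))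
      heavy : All (λ x → δ * ⟦ B ⟧ ≤ d I x) (filterᵇ centreᵇ (tasks I))
      heavy = All.map (λ {x} h → ℚP.≤-trans (ℚP.≤-reflexive (cong (λ e → δ * ⟦ u I e ⟧) (sym (centre-bottleneck x h))))
                                             (large x))
                      (all-filter (λ x → T? (centreᵇ x)) (tasks I))
      centre-on-e₀ : ∀ x → T (centreᵇ x) → T (crit-on-e₀ x)
      centre-on-e₀ x h = ∧-join {critᵇ x} (proj₁ (∧-split h))
                                (inPᵇ-complete x e₀ (subst (InP I x) (centre-bottleneck x h) (bottleneck-on-path x)))

    -- Together with d(m) = δ·B the centre tasks fit into u_{e₀} = B by weak
    -- feasibility at e₀, as m is the heaviest m-task of M' on e₀.
    centre-count : ⟦ suc (size centreᵇ) ⟧ * (δ * ⟦ B ⟧) ≤ ⟦ B ⟧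
    centre-count = begin
      ⟦ suc n ⟧ * (δ * ⟦ B ⟧)         ≡⟨ trans (⟦suc⟧-* n (δ * ⟦ B ⟧)) (ℚP.+-comm (δ * ⟦ B ⟧) _) ⟩
      ⟦ n ⟧ * (δ * ⟦ B ⟧) + δ * ⟦ B ⟧  ≤⟨ ℚP.+-monoˡ-≤ (δ * ⟦ B ⟧) centre-demand ⟩
      dSum I (atEdge I e₀ (abv I T' m)) + dSum I (atEdge I e₀ (crit I δ T' m)) + dM I δ m
                                       ≤⟨ with-m e₀ (proj₁ (bottleneck-valid i)) (proj₂ (bottleneck-valid i))
                                                 i j i,j∈M' (mtask-on-path i j)
                                                 (λ a b in-M' uses-e₀ → mtask-min a b e₀ (M'⊆M a b in-M') uses-e₀) ⟩
      ⟦ B ⟧                            ∎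
      where
      open ℚP.≤-Reasoning
      n = size centreᵇ

    left-bound : count leftᵇ ≤ ⟦ 2 ⟧ * (δ⁻¹ * δ⁻¹)
    left-bound = count-bound (size leftᵇ) K>0 (stack-scale ⟦ B ⟧) left-count

    right-bound : count rightᵇ ≤ ⟦ 2 ⟧ * (δ⁻¹ * δ⁻¹)
    right-bound = count-bound (size rightᵇ) K>0 (stack-scale ⟦ B ⟧) right-count

    centre-bound : count centreᵇ ≤ δ⁻¹
    centre-bound = ℚP.≤-trans (⟦⟧-mono (ℕP.n≤1+n (size centreᵇ)))
                              (count-bound (suc (size centreᵇ)) (ℚP.positive⁻¹ (δ * ⟦ B ⟧) {{ℚP.pos*pos⇒pos δ ⟦ B ⟧}})
                                           (edge-scale ⟦ B ⟧) centre-count)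

lemma7 : (δ : ℚ) (δ>0 : 0ℚ < δ) → δ ≤ 1ℚ →
         (I : Instance) → Standing I → Large I δ →
         (T' : Fin (k I) → Bool) (M' : Fin (k I) → Fin (k I) → Bool) →
         MazePair I T' M' → WeaklyFeasible I δ T' M' →
         ∀ i j → M' i j ≡ true →
         ⟦ length (crit I δ T' (mtask I i j)) ⟧
           ≤ ⟦ 4 ⟧ * (inv δ δ>0 * inv δ δ>0) + inv δ δ>0
lemma7 δ δ>0 _ I standing large T' M' maze feasible i j i,j∈M' = begin
  ⟦ length (crit I δ T' m) ⟧                           ≤⟨ crit-count ⟩
  count leftᵇ + (count rightᵇ + count centreᵇ)         ≤⟨ ℚP.+-mono-≤ left-bound (ℚP.+-mono-≤ right-bound centre-bound) ⟩
  ⟦ 2 ⟧ * (δ⁻¹ * δ⁻¹) + (⟦ 2 ⟧ * (δ⁻¹ * δ⁻¹) + δ⁻¹)   ≡⟨ regroup ⟦ 2 ⟧ (δ⁻¹ * δ⁻¹) δ⁻¹ ⟩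
  (⟦ 2 ⟧ + ⟦ 2 ⟧) * (δ⁻¹ * δ⁻¹) + δ⁻¹                  ≡⟨ cong (λ c → c * (δ⁻¹ * δ⁻¹) + δ⁻¹) (sym (⟦⟧-+ 2 2)) ⟩
  ⟦ 4 ⟧ * (δ⁻¹ * δ⁻¹) + δ⁻¹                            ∎
  where
  open ℚP.≤-Reasoning
  open Scaling δ δ>0
  open Load δ δ>0 I large T' M' maze feasible
  open Critical standing i j i,j∈M'
  regroup : ∀ a y x → a * y + (a * y + x) ≡ (a + a) * y + x
  regroup = solve 3 (λ a y x → a :* y :+ (a :* y :+ x) := (a :+ a) :* y :+ x) refl
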